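{- Let $m_{=1}(n)$ be the number of unlabeled connected $1$-metamour-regular graphs with $n$ vertices. Then $m_{=1}(n)=0$ for odd $n$, $m_{=1}(2)=0$, $m_{=1}(4)=2$, and $m_{=1}(n)=1$ for even $n\ge6$.
   Context: All graphs are finite, simple and have at least one vertex; unlabeled means counted up to isomorphism. A vertex $v$ is a metamour of a vertex $w$ in $G$ if their distance in $G$ equals $2$. $G$ is $1$-metamour-regular if every vertex has exactly one metamour. -}

module Defs where

open import Data.Nat using (ℕ; zero; suc; _<_)
open import Data.Bool using (Bool; true; false)
open import Data.Fin using (Fin)
open import Data.Product using (Σ; ∃; _×_; _,_)
open import Data.Vec.Functional using (Vector)
open import Relation.Binary.PropositionalEquality using (_≡_)
open import Relation.Nullary using (¬_)
open import Function.Bundles using (_↔_; Inverse)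

record Graph (n : ℕ) : Set where
  field
    adj    : Fin n → Fin n → Bool
    sym    : ∀ u v → adj u v ≡ adj v u
    irrefl : ∀ u → adj u u ≡ false
open Graph public

data Walk {n : ℕ} (G : Graph n) : ℕ → Fin n → Fin n → Set where
  here : ∀ {u} → Walk G zero u u
  step : ∀ {k u w v} → adj G u w ≡ true → Walk G k w v → Walk G (suc k) u v

Dist : ∀ {n} → Graph n → Fin n → Fin n → ℕ → Set
Dist G u v d = Walk G d u v × (∀ k → k < d → ¬ Walk G k u v)

Metamour : ∀ {n} → Graph n → Fin n → Fin n → Set
Metamour G v w = Dist G v w 2

OneMetamourRegular : ∀ {n} → Graph n → Set
OneMetamourRegular {n} G =
  ∀ v → Σ (Fin n) λ w → Metamour G v w × (∀ w′ → Metamour G v w′ → w′ ≡ w)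

Connected : ∀ {n} → Graph n → Set
Connected {n} G = ∀ (u v : Fin n) → ∃ λ k → Walk G k u v

Iso : ∀ {n} → Graph n → Graph n → Set
Iso {n} G H = Σ (Fin n ↔ Fin n) λ σ →
  ∀ u v → adj H (Inverse.to σ u) (Inverse.to σ v) ≡ adj G u v

NumIsoClasses : (n : ℕ) → (Graph n → Set) → ℕ → Set
NumIsoClasses n P k =
  Σ (Vector (Graph n) k) λ rep →
      (∀ i → P (rep i))
    × (∀ i j → Iso (rep i) (rep j) → i ≡ j)
    × (∀ G → P G → ∃ λ i → Iso G (rep i))

m₌₁ : ℕ → ℕ → Set
m₌₁ n k = NumIsoClasses n (λ G → Connected G × OneMetamourRegular G) k

-- A 1-metamour-regular graph pairs every vertex v with its unique metamour μ v; μ is a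
-- fixed-point-free involution, so n is even and μ is conjugate to the standard matching.
-- If any two vertices are within distance two, the non-edges are exactly the pairs
-- {v, μ v}, so G is K_n minus a perfect matching (the cocktail-party graph), which is
-- connected and 1-metamour-regular for even n ≥ 4. Otherwise some shortest path
-- a – p – q – b has length three; then μ a = q and μ p = b, no other vertex can be
-- adjacent to the path, and G is P4. For n = 4 the cocktail-party graph is the 4-cycle,
-- not P4; for n = 2 no vertex has a metamour at all.
module Submission where

open import Defs renaming (sym to adj-sym)
open import Data.Nat using (ℕ; zero; suc; _+_; _*_; _≤_; _<_; z≤n; s≤s)
open import Data.Nat.Properties using (*-suc; +-comm; *-monoʳ-≤; ≤-trans)
open import Data.Bool using (Bool; true; false; not)
open import Data.Bool.Properties using (¬-not) renaming (_≟_ to _≟ᵇ_)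
open import Data.Fin using (Fin; zero; suc; punchIn; punchOut)
open import Data.Fin.Properties
  using (_≟_; any?; all?; ¬∀⟶∃¬; injective⇒≤; suc-injective; punchIn-injective; punchInᵢ≢i;
         punchOut-cong; punchIn-punchOut; punchOut-punchIn)
open import Data.Product using (Σ; ∃; _×_; _,_; proj₁; proj₂)
open import Data.Sum using (_⊎_; inj₁; inj₂; [_,_]; map₁)
open import Data.Empty using (⊥; ⊥-elim)
open import Function using (case_of_)
open import Function.Bundles using (Inverse; mk↔ₛ′; mk⇔)
open import Function.Properties.Inverse using (↔-sym)
open import Relation.Nullary using (¬_; Dec; yes; no; does)
open import Relation.Nullary.Decidable
  using (_×-dec_; _⊎-dec_; _→-dec_; ¬?; dec-true; dec-false; does-⇔; from-yes)
open import Relation.Binary.PropositionalEquality using (_≡_; _≢_; refl; sym; trans; cong; cong₂; subst)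
open Relation.Binary.PropositionalEquality.≡-Reasoning

adjacent⇒≢ : ∀ {n} (G : Graph n) {u v} → adj G u v ≡ true → u ≢ v
adjacent⇒≢ G {u} e refl with () ← trans (sym e) (irrefl G u)

walk-snoc : ∀ {n} {G : Graph n} {k u v w} → Walk G k u v → adj G v w ≡ true → Walk G (suc k) u w
walk-snoc here e = step e here
walk-snoc (step e′ p) e = step e′ (walk-snoc p e)

walk-reverse : ∀ {n} {G : Graph n} {k u v} → Walk G k u v → Walk G k v u
walk-reverse here = here
walk-reverse {G = G} (step {u = u} {w} e p) = walk-snoc (walk-reverse p) (trans (adj-sym G w u) e)

walk-++ : ∀ {n} {G : Graph n} {k l u v w} → Walk G k u v → Walk G l v w → Walk G (k + l) u w
walk-++ here q = q
walk-++ (step e p) q = step e (walk-++ p q)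

connected-from : ∀ {n} (G : Graph n) (r : Fin n) → (∀ v → ∃ λ k → Walk G k r v) → Connected G
connected-from G r reach u v with reach u | reach v
... | k , p | l , q = k + l , walk-++ (walk-reverse p) q

CommonNeighbour : ∀ {n} → Graph n → Fin n → Fin n → Set
CommonNeighbour {n} G u v = Σ (Fin n) λ x → adj G u x ≡ true × adj G x v ≡ true

commonNeighbour? : ∀ {n} (G : Graph n) u v → Dec (CommonNeighbour G u v)
commonNeighbour? G u v = any? λ x → (adj G u x ≟ᵇ true) ×-dec (adj G x v ≟ᵇ true)

commonNeighbour-sym : ∀ {n} (G : Graph n) {u v} → CommonNeighbour G u v → CommonNeighbour G v u
commonNeighbour-sym G {u} {v} (x , ux , xv) = x , trans (adj-sym G v x) xv , trans (adj-sym G x u) ux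

Metamour′ : ∀ {n} → Graph n → Fin n → Fin n → Set
Metamour′ G v w = v ≢ w × adj G v w ≡ false × CommonNeighbour G v w

metamour′? : ∀ {n} (G : Graph n) v w → Dec (Metamour′ G v w)
metamour′? G v w = ¬? (v ≟ w) ×-dec (adj G v w ≟ᵇ false) ×-dec commonNeighbour? G v w

metamour⇒metamour′ : ∀ {n} (G : Graph n) {v w} → Metamour G v w → Metamour′ G v w
metamour⇒metamour′ G (step vx (step xw here) , shorter) =
  (λ { refl → shorter 0 (s≤s z≤n) here }) ,
  ¬-not (λ vw → shorter 1 (s≤s (s≤s z≤n)) (step vw here)) ,
  (_ , vx , xw)

metamour′⇒metamour : ∀ {n} (G : Graph n) {v w} → Metamour′ G v w → Metamour G v w
metamour′⇒metamour G {v} {w} (v≢w , v≁w , x , vx , xw) = step vx (step xw here) , shorter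
  where
  shorter : ∀ k → k < 2 → ¬ Walk G k v w
  shorter zero _ here = v≢w refl
  shorter (suc zero) _ (step vw here) with () ← trans (sym vw) v≁w
  shorter (suc (suc k)) (s≤s (s≤s ()))

metamour′-sym : ∀ {n} (G : Graph n) {v w} → Metamour′ G v w → Metamour′ G w v
metamour′-sym G {v} {w} (v≢w , v≁w , c) =
  (λ w≡v → v≢w (sym w≡v)) , trans (adj-sym G w v) v≁w , commonNeighbour-sym G c

metamour′⇒3≤n : ∀ {n} (G : Graph n) {v w} → Metamour′ G v w → 3 ≤ n
metamour′⇒3≤n {n} G {v} {w} (v≢w , _ , x , vx , xw) = injective⇒≤ {f = triple} triple-injective
  where
  triple : Fin 3 → Fin n
  triple zero = v
  triple (suc zero) = x
  triple (suc (suc zero)) = w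
  x≢w : x ≢ w
  x≢w = adjacent⇒≢ G xw
  v≢x : v ≢ x
  v≢x = adjacent⇒≢ G vx
  triple-injective : ∀ {i j} → triple i ≡ triple j → i ≡ j
  triple-injective {zero} {zero} _ = refl
  triple-injective {suc zero} {suc zero} _ = refl
  triple-injective {suc (suc zero)} {suc (suc zero)} _ = refl
  triple-injective {zero} {suc zero} eq = ⊥-elim (v≢x eq)
  triple-injective {zero} {suc (suc zero)} eq = ⊥-elim (v≢w eq)
  triple-injective {suc zero} {zero} eq = ⊥-elim (v≢x (sym eq))
  triple-injective {suc zero} {suc (suc zero)} eq = ⊥-elim (x≢w eq)
  triple-injective {suc (suc zero)} {zero} eq = ⊥-elim (v≢w (sym eq))
  triple-injective {suc (suc zero)} {suc zero} eq = ⊥-elim (x≢w (sym eq))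

record MetamourMap {n} (G : Graph n) : Set where
  field
    μ        : Fin n → Fin n
    metamour : ∀ v → Metamour′ G v (μ v)
    unique   : ∀ v w → Metamour′ G v w → w ≡ μ v

  involutive : ∀ v → μ (μ v) ≡ v
  involutive v = sym (unique (μ v) v (metamour′-sym G (metamour v)))

  fixpoint-free : ∀ v → μ v ≢ v
  fixpoint-free v μv≡v = proj₁ (metamour v) (sym μv≡v)

  adjacent-unless-metamour : ∀ {s t y} → adj G s t ≡ true → adj G t y ≡ true → s ≢ y → y ≢ μ s →
    adj G s y ≡ true
  adjacent-unless-metamour {s} {y = y} st ty s≢y y≢μs with adj G s y in sy
  ... | true = refl
  ... | false = ⊥-elim (y≢μs (unique _ _ (s≢y , sy , _ , st , ty)))

oneMetamourRegular⇒metamourMap : ∀ {n} (G : Graph n) → OneMetamourRegular G → MetamourMap G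
oneMetamourRegular⇒metamourMap G regular = record
  { μ        = λ v → proj₁ (regular v)
  ; metamour = λ v → metamour⇒metamour′ G (proj₁ (proj₂ (regular v)))
  ; unique   = λ v w vw → proj₂ (proj₂ (regular v)) w (metamour′⇒metamour G vw)
  }

metamourMap⇒oneMetamourRegular : ∀ {n} (G : Graph n) → MetamourMap G → OneMetamourRegular G
metamourMap⇒oneMetamourRegular G M v =
  μ v , metamour′⇒metamour G (metamour v) , λ w vw → unique v w (metamour⇒metamour′ G vw)
  where open MetamourMap M

data Even : ℕ → Set where
  even-zero    : Even 0
  even-suc-suc : ∀ {n} → Even n → Even (suc (suc n))

¬even∧even-suc : ∀ {n} → Even n → ¬ Even (suc n)
¬even∧even-suc (even-suc-suc e) (even-suc-suc e′) = ¬even∧even-suc e e′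

even-2* : ∀ k → Even (2 * k)
even-2* zero = even-zero
even-2* (suc k) = subst Even (sym (*-suc 2 k)) (even-suc-suc (even-2* k))

¬even-2*+1 : ∀ k → ¬ Even (2 * k + 1)
¬even-2*+1 k e = ¬even∧even-suc (even-2* k) (subst Even (+-comm (2 * k) 1) e)

-- Swaps 2i and 2i+1; for odd n the last element is fixed.
mate : ∀ {n} → Fin n → Fin n
mate {suc zero} zero = zero
mate {suc (suc n)} zero = suc zero
mate {suc (suc n)} (suc zero) = zero
mate {suc (suc n)} (suc (suc x)) = suc (suc (mate x))

mate-involutive : ∀ {n} (x : Fin n) → mate (mate x) ≡ x
mate-involutive {suc zero} zero = refl
mate-involutive {suc (suc n)} zero = refl
mate-involutive {suc (suc n)} (suc zero) = refl
mate-involutive {suc (suc n)} (suc (suc x)) = cong (λ y → suc (suc y)) (mate-involutive x)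

mate-injective : ∀ {n} {x y : Fin n} → mate x ≡ mate y → x ≡ y
mate-injective {x = x} {y} eq = begin
  x             ≡⟨ sym (mate-involutive x) ⟩
  mate (mate x) ≡⟨ cong mate eq ⟩
  mate (mate y) ≡⟨ mate-involutive y ⟩
  y             ∎

mate-fixpoint-free : ∀ {n} → Even n → (x : Fin n) → mate x ≢ x
mate-fixpoint-free (even-suc-suc e) zero ()
mate-fixpoint-free (even-suc-suc e) (suc zero) ()
mate-fixpoint-free (even-suc-suc e) (suc (suc x)) eq =
  mate-fixpoint-free e x (suc-injective (suc-injective eq))

record ConjugateToMate {n} (f : Fin n → Fin n) : Set where
  field
    even   : Even n
    σ σ⁻¹  : Fin n → Fin n
    σ⁻¹∘σ  : ∀ x → σ⁻¹ (σ x) ≡ x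
    σ∘σ⁻¹  : ∀ y → σ (σ⁻¹ y) ≡ y
    σ∘f    : ∀ x → σ (f x) ≡ mate (σ x)

  σ-injective : ∀ {x y} → σ x ≡ σ y → x ≡ y
  σ-injective {x} {y} eq = trans (sym (σ⁻¹∘σ x)) (trans (cong σ⁻¹ eq) (σ⁻¹∘σ y))

-- An involution f of Fin (2 + n) with f 0 = 1 + j restricts to an involution of the
-- remaining n points, enumerated by embed; a conjugation of the restriction extends.
module RemovePair {n} (f : Fin (suc (suc n)) → Fin (suc (suc n)))
  (f-involutive : ∀ x → f (f x) ≡ x) (f-fixpoint-free : ∀ x → f x ≢ x)
  (j : Fin (suc n)) (f0≡j : f zero ≡ suc j) where

  embed : Fin n → Fin (suc (suc n))
  embed x = suc (punchIn j x)

  embed-injective : ∀ {x y} → embed x ≡ embed y → x ≡ y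
  embed-injective eq = punchIn-injective j _ _ (suc-injective eq)

  fj≡0 : f (suc j) ≡ zero
  fj≡0 = trans (cong f (sym f0≡j)) (f-involutive zero)

  embed≢j : ∀ x → embed x ≢ suc j
  embed≢j x eq = punchInᵢ≢i j x (suc-injective eq)

  data Position : Fin (suc (suc n)) → Set where
    first   : Position zero
    partner : Position (suc j)
    rest    : ∀ x → Position (embed x)

  position : ∀ y → Position y
  position zero = first
  position (suc y) with j ≟ y
  ... | yes refl = partner
  ... | no j≢y = subst Position (cong suc (punchIn-punchOut j≢y)) (rest (punchOut j≢y))

  f-rest : ∀ x → Σ (Fin n) λ x′ → f (embed x) ≡ embed x′
  f-rest x = from-position (f (embed x)) refl (position (f (embed x)))
    where
    from-position : ∀ y → f (embed x) ≡ y → Position y → Σ (Fin n) λ x′ → f (embed x) ≡ embed x′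
    from-position .zero eq first =
      ⊥-elim (embed≢j x (trans (sym (f-involutive (embed x))) (trans (cong f eq) f0≡j)))
    from-position .(suc j) eq partner
      with () ← trans (sym (f-involutive (embed x))) (trans (cong f eq) fj≡0)
    from-position .(embed x′) eq (rest x′) = x′ , eq

  restrict : Fin n → Fin n
  restrict x = proj₁ (f-rest x)

  f∘embed : ∀ x → f (embed x) ≡ embed (restrict x)
  f∘embed x = proj₂ (f-rest x)

  restrict-involutive : ∀ x → restrict (restrict x) ≡ x
  restrict-involutive x = embed-injective (begin
    embed (restrict (restrict x)) ≡⟨ sym (f∘embed (restrict x)) ⟩
    f (embed (restrict x))        ≡⟨ cong f (sym (f∘embed x)) ⟩
    f (f (embed x))               ≡⟨ f-involutive (embed x) ⟩
    embed x                       ∎)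

  restrict-fixpoint-free : ∀ x → restrict x ≢ x
  restrict-fixpoint-free x eq = f-fixpoint-free (embed x) (trans (f∘embed x) (cong embed eq))

  extend : ConjugateToMate restrict → ConjugateToMate f
  extend C = record
    { even  = even-suc-suc C.even
    ; σ     = σ
    ; σ⁻¹   = σ⁻¹
    ; σ⁻¹∘σ = λ y → σ⁻¹∘σ (position y)
    ; σ∘σ⁻¹ = σ∘σ⁻¹
    ; σ∘f   = λ y → σ∘f (position y)
    }
    where
    module C = ConjugateToMate C

    σ : Fin (suc (suc n)) → Fin (suc (suc n))
    σ zero = zero
    σ (suc y) with j ≟ y
    ... | yes _ = suc zero
    ... | no j≢y = suc (suc (C.σ (punchOut j≢y)))

    σ-embed : ∀ x → σ (embed x) ≡ suc (suc (C.σ x))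
    σ-embed x with j ≟ punchIn j x
    ... | yes j≡ = ⊥-elim (punchInᵢ≢i j x (sym j≡))
    ... | no _ = cong (λ z → suc (suc (C.σ z))) (trans (punchOut-cong j refl) (punchOut-punchIn j))

    σ-partner : σ (suc j) ≡ suc zero
    σ-partner with j ≟ j
    ... | yes _ = refl
    ... | no j≢j = ⊥-elim (j≢j refl)

    σ⁻¹ : Fin (suc (suc n)) → Fin (suc (suc n))
    σ⁻¹ zero = zero
    σ⁻¹ (suc zero) = suc j
    σ⁻¹ (suc (suc y)) = embed (C.σ⁻¹ y)

    σ⁻¹∘σ : ∀ {y} → Position y → σ⁻¹ (σ y) ≡ y
    σ⁻¹∘σ first = refl
    σ⁻¹∘σ partner = cong σ⁻¹ σ-partner
    σ⁻¹∘σ (rest x) = trans (cong σ⁻¹ (σ-embed x)) (cong embed (C.σ⁻¹∘σ x))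

    σ∘σ⁻¹ : ∀ y → σ (σ⁻¹ y) ≡ y
    σ∘σ⁻¹ zero = refl
    σ∘σ⁻¹ (suc zero) = σ-partner
    σ∘σ⁻¹ (suc (suc y)) = trans (σ-embed (C.σ⁻¹ y)) (cong (λ z → suc (suc z)) (C.σ∘σ⁻¹ y))

    σ∘f : ∀ {y} → Position y → σ (f y) ≡ mate (σ y)
    σ∘f first = trans (cong σ f0≡j) σ-partner
    σ∘f partner = trans (cong σ fj≡0) (sym (cong mate σ-partner))
    σ∘f (rest x) = begin
      σ (f (embed x))                ≡⟨ cong σ (f∘embed x) ⟩
      σ (embed (restrict x))         ≡⟨ σ-embed (restrict x) ⟩
      suc (suc (C.σ (restrict x)))   ≡⟨ cong (λ z → suc (suc z)) (C.σ∘f x) ⟩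
      suc (suc (mate (C.σ x)))       ≡⟨ cong mate (sym (σ-embed x)) ⟩
      mate (σ (embed x))             ∎

conjugate-to-mate : ∀ n (f : Fin n → Fin n) → (∀ x → f (f x) ≡ x) → (∀ x → f x ≢ x) →
  ConjugateToMate f
conjugate-to-mate zero _ _ _ = record
  { even = even-zero ; σ = λ x → x ; σ⁻¹ = λ x → x
  ; σ⁻¹∘σ = λ _ → refl ; σ∘σ⁻¹ = λ _ → refl ; σ∘f = λ () }
conjugate-to-mate (suc zero) f _ fixpoint-free with f zero in eq
... | zero = ⊥-elim (fixpoint-free zero eq)
conjugate-to-mate (suc (suc n)) f involutive fixpoint-free with f zero in eq
... | zero = ⊥-elim (fixpoint-free zero eq)
... | suc j = extend (conjugate-to-mate n restrict restrict-involutive restrict-fixpoint-free)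
  where open RemovePair f involutive fixpoint-free j eq

metamourMap⇒even : ∀ {n} (G : Graph n) → MetamourMap G → Even n
metamourMap⇒even {n} G M = ConjugateToMate.even (conjugate-to-mate n μ involutive fixpoint-free)
  where open MetamourMap M

module _ {A : Set} where

  not-does≡false⇒ : (a? : Dec A) → not (does a?) ≡ false → A
  not-does≡false⇒ (yes a) _ = a

  ≡not-does : ∀ {b} (a? : Dec A) → (b ≡ false → A) → (A → b ≡ false) → b ≡ not (does a?)
  ≡not-does {false} (yes _) _ _ = refl
  ≡not-does {false} (no ¬a) b⇒a _ = ⊥-elim (¬a (b⇒a refl))
  ≡not-does {true} (yes a) _ a⇒b = a⇒b a
  ≡not-does {true} (no _) _ _ = refl

Matched : ∀ {n} → Fin n → Fin n → Set
Matched x y = x ≡ y ⊎ y ≡ mate x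

matched? : ∀ {n} (x y : Fin n) → Dec (Matched x y)
matched? x y = (x ≟ y) ⊎-dec (y ≟ mate x)

matched-sym : ∀ {n} {x y : Fin n} → Matched x y → Matched y x
matched-sym (inj₁ x≡y) = inj₁ (sym x≡y)
matched-sym (inj₂ refl) = inj₂ (sym (mate-involutive _))

cp-adj : ∀ {n} → Fin n → Fin n → Bool
cp-adj x y = not (does (matched? x y))

cp-adj-false⇒matched : ∀ {n} {x y : Fin n} → cp-adj x y ≡ false → Matched x y
cp-adj-false⇒matched {x = x} {y} = not-does≡false⇒ (matched? x y)

matched⇒cp-adj-false : ∀ {n} {x y : Fin n} → Matched x y → cp-adj x y ≡ false
matched⇒cp-adj-false {x = x} {y} m = cong not (dec-true (matched? x y) m)

cp-adj-sym : ∀ {n} (x y : Fin n) → cp-adj x y ≡ cp-adj y x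
cp-adj-sym x y = cong not (does-⇔ (mk⇔ matched-sym matched-sym) (matched? x y) (matched? y x))

CocktailParty : ∀ n → Graph n
CocktailParty n = record
  { adj    = cp-adj
  ; sym    = cp-adj-sym
  ; irrefl = λ x → matched⇒cp-adj-false {x = x} (inj₁ refl)
  }

¬matched⇒cp-adj-true : ∀ {n} {x y : Fin n} → ¬ Matched x y → cp-adj x y ≡ true
¬matched⇒cp-adj-true {x = x} {y} ¬m = cong not (dec-false (matched? x y) ¬m)

outside-matched-pair : ∀ {n} (u : Fin (suc (suc (suc n)))) → ∃ λ w → w ≢ u × w ≢ mate u
outside-matched-pair zero = suc (suc zero) , (λ ()) , (λ ())
outside-matched-pair (suc zero) = suc (suc zero) , (λ ()) , (λ ())
outside-matched-pair (suc (suc u)) = zero , (λ ()) , (λ ())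

cp-commonNeighbour-mate : ∀ {n} (u : Fin (suc (suc (suc n)))) →
  CommonNeighbour (CocktailParty _) u (mate u)
cp-commonNeighbour-mate u with outside-matched-pair u
... | w , w≢u , w≢μu = w ,
  ¬matched⇒cp-adj-true [ (λ u≡w → w≢u (sym u≡w)) , w≢μu ] ,
  ¬matched⇒cp-adj-true [ w≢μu , (λ μu≡μw → w≢u (mate-injective (sym μu≡μw))) ]

cocktailParty-connected : ∀ {n} → 3 ≤ n → Connected (CocktailParty n)
cocktailParty-connected (s≤s (s≤s (s≤s _))) u v with matched? u v
... | no ¬m = 1 , step (¬matched⇒cp-adj-true ¬m) here
... | yes (inj₁ refl) = 0 , here
... | yes (inj₂ refl) with cp-commonNeighbour-mate u
...   | w , uw , wv = 2 , step uw (step wv here)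

cocktailParty-metamourMap : ∀ {n} → Even n → 3 ≤ n → MetamourMap (CocktailParty n)
cocktailParty-metamourMap even (s≤s (s≤s (s≤s _))) = record
  { μ        = mate
  ; metamour = λ v → (λ v≡μv → mate-fixpoint-free even v (sym v≡μv)) ,
                     matched⇒cp-adj-false {x = v} (inj₂ refl) ,
                     cp-commonNeighbour-mate v
  ; unique   = λ v w (v≢w , v≁w , _) → case cp-adj-false⇒matched v≁w of λ
                 { (inj₁ v≡w) → ⊥-elim (v≢w v≡w)
                 ; (inj₂ w≡μv) → w≡μv }
  }

WithinTwo : ∀ {n} → Graph n → Fin n → Fin n → Set
WithinTwo G u v = u ≡ v ⊎ adj G u v ≡ true ⊎ CommonNeighbour G u v

withinTwo? : ∀ {n} (G : Graph n) u v → Dec (WithinTwo G u v)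
withinTwo? G u v = (u ≟ v) ⊎-dec (adj G u v ≟ᵇ true) ⊎-dec commonNeighbour? G u v

withinTwo-sym : ∀ {n} (G : Graph n) {u v} → WithinTwo G u v → WithinTwo G v u
withinTwo-sym G (inj₁ u≡v) = inj₁ (sym u≡v)
withinTwo-sym G {u} {v} (inj₂ (inj₁ uv)) = inj₂ (inj₁ (trans (adj-sym G v u) uv))
withinTwo-sym G (inj₂ (inj₂ c)) = inj₂ (inj₂ (commonNeighbour-sym G c))

record Geodesic₃ {n} (G : Graph n) : Set where
  field
    a p q b : Fin n
    ap : adj G a p ≡ true
    pq : adj G p q ≡ true
    qb : adj G q b ≡ true
    a-far-b : ¬ WithinTwo G a b

  reverse : Geodesic₃ G
  reverse = record
    { a = b ; p = q ; q = p ; b = a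
    ; ap = trans (adj-sym G b q) qb
    ; pq = trans (adj-sym G q p) pq
    ; qb = trans (adj-sym G p a) ap
    ; a-far-b = λ w → a-far-b (withinTwo-sym G w) }

-- The path starts at the predecessor of the first vertex of the walk within distance two of v.
walk⇒geodesic₃ : ∀ {n} (G : Graph n) {k u v} → Walk G k u v → ¬ WithinTwo G u v → Geodesic₃ G
walk⇒geodesic₃ G here far = ⊥-elim (far (inj₁ refl))
walk⇒geodesic₃ G {u = u} {v} (step {w = w} uw walk) far with withinTwo? G w v
... | no w-far = walk⇒geodesic₃ G walk w-far
... | yes (inj₁ refl) = ⊥-elim (far (inj₂ (inj₁ uw)))
... | yes (inj₂ (inj₁ wv)) = ⊥-elim (far (inj₂ (inj₂ (w , uw , wv))))
... | yes (inj₂ (inj₂ (x , wx , xv))) = record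
  { a = u ; p = w ; q = x ; b = v ; ap = uw ; pq = wx ; qb = xv ; a-far-b = far }

diameter≤2⊎geodesic₃ : ∀ {n} (G : Graph n) → Connected G →
  (∀ u v → WithinTwo G u v) ⊎ Geodesic₃ G
diameter≤2⊎geodesic₃ {n} G connected with all? (λ u → all? (λ v → withinTwo? G u v))
... | yes close = inj₁ close
... | no ¬close with ¬∀⟶∃¬ n _ (λ u → all? (λ v → withinTwo? G u v)) ¬close
...   | u , ¬close-u with ¬∀⟶∃¬ n _ (withinTwo? G u) ¬close-u
...     | v , far = inj₂ (walk⇒geodesic₃ G (proj₂ (connected u v)) far)

diameter≤2⇒≅cocktailParty : ∀ {n} (G : Graph n) → MetamourMap G → (∀ u v → WithinTwo G u v) →
  Iso G (CocktailParty n)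
diameter≤2⇒≅cocktailParty {n} G M close = mk↔ₛ′ σ σ⁻¹ σ∘σ⁻¹ σ⁻¹∘σ , preserves
  where
  open MetamourMap M
  open ConjugateToMate (conjugate-to-mate n μ involutive fixpoint-free)

  nonadjacent⇒self⊎metamour : ∀ {u v} → adj G u v ≡ false → u ≡ v ⊎ v ≡ μ u
  nonadjacent⇒self⊎metamour {u} {v} u≁v with close u v | u ≟ v
  ... | inj₁ u≡v | _ = inj₁ u≡v
  ... | inj₂ (inj₁ uv) | _ with () ← trans (sym uv) u≁v
  ... | inj₂ (inj₂ _) | yes u≡v = inj₁ u≡v
  ... | inj₂ (inj₂ c) | no u≢v = inj₂ (unique u v (u≢v , u≁v , c))

  matched⇒nonadjacent : ∀ {u v} → Matched (σ u) (σ v) → adj G u v ≡ false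
  matched⇒nonadjacent {u} (inj₁ σu≡σv) =
    subst (λ v → adj G u v ≡ false) (σ-injective σu≡σv) (irrefl G u)
  matched⇒nonadjacent {u} (inj₂ σv≡mate) =
    subst (λ v → adj G u v ≡ false) (sym (σ-injective (trans σv≡mate (sym (σ∘f u)))))
      (proj₁ (proj₂ (metamour u)))

  nonadjacent⇒matched : ∀ {u v} → adj G u v ≡ false → Matched (σ u) (σ v)
  nonadjacent⇒matched u≁v with nonadjacent⇒self⊎metamour u≁v
  ... | inj₁ refl = inj₁ refl
  ... | inj₂ refl = inj₂ (σ∘f _)

  preserves : ∀ u v → cp-adj (σ u) (σ v) ≡ adj G u v
  preserves u v = sym (≡not-does (matched? (σ u) (σ v)) nonadjacent⇒matched matched⇒nonadjacent)

module Geodesic₃Properties {n} {G : Graph n} (P : Geodesic₃ G) where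
  open Geodesic₃ P

  OnPath : Fin n → Set
  OnPath y = y ≡ a ⊎ y ≡ p ⊎ y ≡ q ⊎ y ≡ b

  onPath? : ∀ y → Dec (OnPath y)
  onPath? y = (y ≟ a) ⊎-dec (y ≟ p) ⊎-dec (y ≟ q) ⊎-dec (y ≟ b)

  a≁b : adj G a b ≡ false
  a≁b = ¬-not λ ab → a-far-b (inj₂ (inj₁ ab))

  a≁q : adj G a q ≡ false
  a≁q = ¬-not λ aq → a-far-b (inj₂ (inj₂ (q , aq , qb)))

  p≁b : adj G p b ≡ false
  p≁b = ¬-not λ pb → a-far-b (inj₂ (inj₂ (p , ap , pb)))

  a≢b : a ≢ b
  a≢b a≡b = a-far-b (inj₁ a≡b)

  a≢q : a ≢ q
  a≢q refl = a-far-b (inj₂ (inj₁ qb))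

  p≢b : p ≢ b
  p≢b refl = a-far-b (inj₂ (inj₁ ap))

  a-metamour-q : Metamour′ G a q
  a-metamour-q = a≢q , a≁q , p , ap , pq

  p-metamour-b : Metamour′ G p b
  p-metamour-b = p≢b , p≁b , q , pq , qb

  module _ (M : MetamourMap G) where
    open MetamourMap M

    μa≡q : μ a ≡ q
    μa≡q = sym (unique a q a-metamour-q)

    μq≡a : μ q ≡ a
    μq≡a = sym (unique q a (metamour′-sym G a-metamour-q))

    μp≡b : μ p ≡ b
    μp≡b = sym (unique p b p-metamour-b)

    μb≡p : μ b ≡ p
    μb≡p = sym (unique b p (metamour′-sym G p-metamour-b))

    adjacent-to-outsider : ∀ {s t y} → ¬ OnPath y → OnPath s → OnPath (μ s) →
      adj G s t ≡ true → adj G t y ≡ true → adj G s y ≡ true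
    adjacent-to-outsider off s-on μs-on st ty =
      adjacent-unless-metamour st ty (λ { refl → off s-on }) (λ { refl → off μs-on })

    -- A neighbour y of p off the path is adjacent to a, q and then b (none of them
    -- has y as its metamour), putting a and b at distance two.
    no-outside-neighbour-of-p : ∀ {y} → ¬ OnPath y → adj G y p ≡ true → ⊥
    no-outside-neighbour-of-p {y} off yp = a-far-b (inj₂ (inj₂ (y , ay , trans (adj-sym G y b) by)))
      where
      py = trans (adj-sym G p y) yp
      ay = adjacent-to-outsider off (inj₁ refl) (inj₂ (inj₂ (inj₁ μa≡q))) ap py
      qy = adjacent-to-outsider off (inj₂ (inj₂ (inj₁ refl))) (inj₁ μq≡a)
             (trans (adj-sym G q p) pq) py
      by = adjacent-to-outsider off (inj₂ (inj₂ (inj₂ refl))) (inj₂ (inj₁ μb≡p))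
             (trans (adj-sym G b q) qb) qy

    no-outside-neighbour-of-a : ∀ {y} → ¬ OnPath y → adj G y a ≡ true → ⊥
    no-outside-neighbour-of-a {y} off ya = no-outside-neighbour-of-p off (trans (adj-sym G y p) py)
      where
      py = adjacent-to-outsider off (inj₂ (inj₁ refl)) (inj₂ (inj₂ (inj₂ μp≡b)))
             (trans (adj-sym G p a) ap) (trans (adj-sym G a y) ya)

pattern v₀ = zero
pattern v₁ = suc zero
pattern v₂ = suc (suc zero)
pattern v₃ = suc (suc (suc zero))

module Geodesic₃Spanning {n} {G : Graph n} (connected : Connected G) (M : MetamourMap G) (P : Geodesic₃ G)
  where
  open Geodesic₃ P
  open Geodesic₃Properties P
  module R = Geodesic₃Properties reverse

  onPath-reverse : ∀ {y} → R.OnPath y → OnPath y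
  onPath-reverse (inj₁ y≡b) = inj₂ (inj₂ (inj₂ y≡b))
  onPath-reverse (inj₂ (inj₁ y≡q)) = inj₂ (inj₂ (inj₁ y≡q))
  onPath-reverse (inj₂ (inj₂ (inj₁ y≡p))) = inj₂ (inj₁ y≡p)
  onPath-reverse (inj₂ (inj₂ (inj₂ y≡a))) = inj₁ y≡a

  no-outside-neighbour : ∀ {y s} → ¬ OnPath y → OnPath s → adj G y s ≡ true → ⊥
  no-outside-neighbour off (inj₁ refl) = no-outside-neighbour-of-a M off
  no-outside-neighbour off (inj₂ (inj₁ refl)) = no-outside-neighbour-of-p M off
  no-outside-neighbour off (inj₂ (inj₂ (inj₁ refl))) =
    R.no-outside-neighbour-of-p M (λ on → off (onPath-reverse on))
  no-outside-neighbour off (inj₂ (inj₂ (inj₂ refl))) =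
    R.no-outside-neighbour-of-a M (λ on → off (onPath-reverse on))

  walk-stays-on-path : ∀ {k s z} → Walk G k s z → OnPath s → OnPath z
  walk-stays-on-path here s-on = s-on
  walk-stays-on-path {s = s} (step {w = w} sw walk) s-on with onPath? w
  ... | yes w-on = walk-stays-on-path walk w-on
  ... | no w-off = ⊥-elim (no-outside-neighbour w-off s-on (trans (adj-sym G w s) sw))

  onPath : ∀ z → OnPath z
  onPath z = walk-stays-on-path (proj₂ (connected a z)) (inj₁ refl)

  vertex : Fin 4 → Fin n
  vertex v₀ = a
  vertex v₁ = p
  vertex v₂ = q
  vertex v₃ = b

  index : Fin n → Fin 4
  index z with onPath z
  ... | inj₁ _ = v₀
  ... | inj₂ (inj₁ _) = v₁
  ... | inj₂ (inj₂ (inj₁ _)) = v₂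
  ... | inj₂ (inj₂ (inj₂ _)) = v₃

  vertex∘index : ∀ z → vertex (index z) ≡ z
  vertex∘index z with onPath z
  ... | inj₁ refl = refl
  ... | inj₂ (inj₁ refl) = refl
  ... | inj₂ (inj₂ (inj₁ refl)) = refl
  ... | inj₂ (inj₂ (inj₂ refl)) = refl

  index-injective : ∀ {u v} → index u ≡ index v → u ≡ v
  index-injective {u} {v} eq =
    trans (sym (vertex∘index u)) (trans (cong vertex eq) (vertex∘index v))

  ≤4 : n ≤ 4
  ≤4 = injective⇒≤ index-injective

p4-adj : Fin 4 → Fin 4 → Bool
p4-adj v₀ v₁ = true
p4-adj v₁ v₀ = true
p4-adj v₁ v₂ = true
p4-adj v₂ v₁ = true
p4-adj v₂ v₃ = true
p4-adj v₃ v₂ = true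
p4-adj _  _  = false

P4 : Graph 4
P4 = record
  { adj    = p4-adj
  ; sym    = from-yes (all? λ u → all? λ v → p4-adj u v ≟ᵇ p4-adj v u)
  ; irrefl = from-yes (all? λ u → p4-adj u u ≟ᵇ false)
  }

P4-connected : Connected P4
P4-connected = connected-from P4 v₀ λ
  { v₀ → 0 , here
  ; v₁ → 1 , step refl here
  ; v₂ → 2 , step {w = v₁} refl (step refl here)
  ; v₃ → 3 , step {w = v₁} refl (step {w = v₂} refl (step refl here))
  }

P4-metamourMap : MetamourMap P4
P4-metamourMap = record
  { μ        = μ
  ; metamour = from-yes (all? λ v → metamour′? P4 v (μ v))
  ; unique   = from-yes (all? λ v → all? λ w → metamour′? P4 v w →-dec (w ≟ μ v))
  }
  where
  μ : Fin 4 → Fin 4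
  μ v₀ = v₂
  μ v₁ = v₃
  μ v₂ = v₀
  μ v₃ = v₁

geodesic₃⇒≅P4 : (G : Graph 4) → Connected G → MetamourMap G → Geodesic₃ G → Iso G P4
geodesic₃⇒≅P4 G connected M P = mk↔ₛ′ index vertex index∘vertex vertex∘index , preserves
  where
  open Geodesic₃ P
  open Geodesic₃Properties P
  open Geodesic₃Spanning connected M P

  a≢p = adjacent⇒≢ G ap
  p≢q = adjacent⇒≢ G pq
  q≢b = adjacent⇒≢ G qb

  vertex-injective : ∀ i j → vertex i ≡ vertex j → i ≡ j
  vertex-injective v₀ v₀ _ = refl
  vertex-injective v₁ v₁ _ = refl
  vertex-injective v₂ v₂ _ = refl
  vertex-injective v₃ v₃ _ = refl
  vertex-injective v₀ v₁ a≡p = ⊥-elim (a≢p a≡p)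
  vertex-injective v₀ v₂ a≡q = ⊥-elim (a≢q a≡q)
  vertex-injective v₀ v₃ a≡b = ⊥-elim (a≢b a≡b)
  vertex-injective v₁ v₂ p≡q = ⊥-elim (p≢q p≡q)
  vertex-injective v₁ v₃ p≡b = ⊥-elim (p≢b p≡b)
  vertex-injective v₂ v₃ q≡b = ⊥-elim (q≢b q≡b)
  vertex-injective v₁ v₀ p≡a = ⊥-elim (a≢p (sym p≡a))
  vertex-injective v₂ v₀ q≡a = ⊥-elim (a≢q (sym q≡a))
  vertex-injective v₃ v₀ b≡a = ⊥-elim (a≢b (sym b≡a))
  vertex-injective v₂ v₁ q≡p = ⊥-elim (p≢q (sym q≡p))
  vertex-injective v₃ v₁ b≡p = ⊥-elim (p≢b (sym b≡p))
  vertex-injective v₃ v₂ b≡q = ⊥-elim (q≢b (sym b≡q))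

  index∘vertex : ∀ i → index (vertex i) ≡ i
  index∘vertex i = vertex-injective _ _ (vertex∘index (vertex i))

  adj-vertex : ∀ i j → p4-adj i j ≡ adj G (vertex i) (vertex j)
  adj-vertex v₀ v₀ = sym (irrefl G a)
  adj-vertex v₀ v₁ = sym ap
  adj-vertex v₀ v₂ = sym a≁q
  adj-vertex v₀ v₃ = sym a≁b
  adj-vertex v₁ v₀ = sym (trans (adj-sym G p a) ap)
  adj-vertex v₁ v₁ = sym (irrefl G p)
  adj-vertex v₁ v₂ = sym pq
  adj-vertex v₁ v₃ = sym p≁b
  adj-vertex v₂ v₀ = sym (trans (adj-sym G q a) a≁q)
  adj-vertex v₂ v₁ = sym (trans (adj-sym G q p) pq)
  adj-vertex v₂ v₂ = sym (irrefl G q)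
  adj-vertex v₂ v₃ = sym qb
  adj-vertex v₃ v₀ = sym (trans (adj-sym G b a) a≁b)
  adj-vertex v₃ v₁ = sym (trans (adj-sym G b p) p≁b)
  adj-vertex v₃ v₂ = sym (trans (adj-sym G b q) qb)
  adj-vertex v₃ v₃ = sym (irrefl G b)

  preserves : ∀ u v → p4-adj (index u) (index v) ≡ adj G u v
  preserves u v =
    trans (adj-vertex (index u) (index v)) (cong₂ (adj G) (vertex∘index u) (vertex∘index v))

iso-sym : ∀ {n} {G H : Graph n} → Iso G H → Iso H G
iso-sym {H = H} (σ , preserves) = ↔-sym σ , λ u v →
  trans (sym (preserves (from u) (from v))) (cong₂ (adj H) (strictlyInverseˡ u) (strictlyInverseˡ v))
  where open Inverse σ

-- The cocktail-party graph on 4 vertices is the 4-cycle: no vertex is a leaf, unlike v₀ in P4.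
¬cocktailParty4≅P4 : ¬ Iso (CocktailParty 4) P4
¬cocktailParty4≅P4 (σ , preserves) = case two-neighbours (from v₀) of λ
  { (x , y , x≢y , ux , uy) → x≢y (to-injective (trans (to-leaf x ux) (sym (to-leaf y uy)))) }
  where
  open Inverse σ

  two-neighbours : ∀ (u : Fin 4) →
    Σ (Fin 4) λ x → Σ (Fin 4) λ y → x ≢ y × cp-adj u x ≡ true × cp-adj u y ≡ true
  two-neighbours = from-yes (all? λ (u : Fin 4) → any? λ x → any? λ y →
    ¬? (x ≟ y) ×-dec (cp-adj u x ≟ᵇ true) ×-dec (cp-adj u y ≟ᵇ true))

  leaf : ∀ z → p4-adj v₀ z ≡ true → z ≡ v₁
  leaf = from-yes (all? λ z → (p4-adj v₀ z ≟ᵇ true) →-dec (z ≟ v₁))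

  to-leaf : ∀ z → cp-adj (from v₀) z ≡ true → to z ≡ v₁
  to-leaf z e = leaf (to z) (begin
    p4-adj v₀ (to z)               ≡⟨ cong (λ w → p4-adj w (to z)) (sym (strictlyInverseˡ v₀)) ⟩
    p4-adj (to (from v₀)) (to z)   ≡⟨ preserves (from v₀) z ⟩
    cp-adj (from v₀) z             ≡⟨ e ⟩
    true                           ∎)

  to-injective : ∀ {x y} → to x ≡ to y → x ≡ y
  to-injective {x} {y} eq =
    trans (sym (strictlyInverseʳ x)) (trans (cong from eq) (strictlyInverseʳ y))

classification : ∀ {n} (G : Graph n) → Connected G → MetamourMap G →
  Iso G (CocktailParty n) ⊎ Geodesic₃ G
classification G connected M =
  map₁ (diameter≤2⇒≅cocktailParty G M) (diameter≤2⊎geodesic₃ G connected)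

m₌₁-odd : ∀ k → m₌₁ (2 * k + 1) 0
m₌₁-odd k = (λ ()) , (λ ()) , (λ ()) , λ G (_ , regular) →
  ⊥-elim (¬even-2*+1 k (metamourMap⇒even G (oneMetamourRegular⇒metamourMap G regular)))

m₌₁-2 : m₌₁ 2 0
m₌₁-2 = (λ ()) , (λ ()) , (λ ()) , λ G (_ , regular) →
  case metamour′⇒3≤n G (MetamourMap.metamour (oneMetamourRegular⇒metamourMap G regular) zero) of λ
    { (s≤s (s≤s ())) }

representatives₄ : Fin 2 → Graph 4
representatives₄ v₀ = CocktailParty 4
representatives₄ v₁ = P4

m₌₁-4 : m₌₁ 4 2
m₌₁-4 = representatives₄ , properties , distinct , complete
  where
  properties : ∀ i → Connected (representatives₄ i) × OneMetamourRegular (representatives₄ i)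
  properties v₀ = cocktailParty-connected (s≤s (s≤s (s≤s z≤n))) ,
    metamourMap⇒oneMetamourRegular _ (cocktailParty-metamourMap (even-2* 2) (s≤s (s≤s (s≤s z≤n))))
  properties v₁ = P4-connected , metamourMap⇒oneMetamourRegular P4 P4-metamourMap

  distinct : ∀ i j → Iso (representatives₄ i) (representatives₄ j) → i ≡ j
  distinct v₀ v₀ _ = refl
  distinct v₁ v₁ _ = refl
  distinct v₀ v₁ iso = ⊥-elim (¬cocktailParty4≅P4 iso)
  distinct v₁ v₀ iso = ⊥-elim (¬cocktailParty4≅P4 (iso-sym {G = P4} {H = CocktailParty 4} iso))

  complete : ∀ G → Connected G × OneMetamourRegular G → ∃ λ i → Iso G (representatives₄ i)
  complete G (connected , regular) = case classification G connected M of λ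
    { (inj₁ iso) → v₀ , iso
    ; (inj₂ P) → v₁ , geodesic₃⇒≅P4 G connected M P }
    where M = oneMetamourRegular⇒metamourMap G regular

m₌₁-2k : ∀ k → 3 ≤ k → m₌₁ (2 * k) 1
m₌₁-2k k 3≤k =
  (λ _ → CocktailParty (2 * k)) , (λ _ → properties) , (λ { zero zero _ → refl }) , complete
  where
  6≤2k : 6 ≤ 2 * k
  6≤2k = *-monoʳ-≤ 2 3≤k

  3≤2k : 3 ≤ 2 * k
  3≤2k = ≤-trans (s≤s (s≤s (s≤s z≤n))) 6≤2k

  properties : Connected (CocktailParty (2 * k)) × OneMetamourRegular (CocktailParty (2 * k))
  properties = cocktailParty-connected 3≤2k ,
    metamourMap⇒oneMetamourRegular _ (cocktailParty-metamourMap (even-2* k) 3≤2k)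

  complete : ∀ G → Connected G × OneMetamourRegular G → ∃ λ i → Iso G (CocktailParty (2 * k))
  complete G (connected , regular) = case classification G connected M of λ
    { (inj₁ iso) → zero , iso
    ; (inj₂ P) → case ≤-trans 6≤2k (Geodesic₃Spanning.≤4 connected M P) of λ
                   { (s≤s (s≤s (s≤s (s≤s ())))) } }
    where M = oneMetamourRegular⇒metamourMap G regular

corollary3p7 : (∀ k → m₌₁ (2 * k + 1) 0)
    × m₌₁ 2 0
    × m₌₁ 4 2
    × (∀ k → 3 ≤ k → m₌₁ (2 * k) 1)
corollary3p7 = m₌₁-odd , m₌₁-2 , m₌₁-4 , m₌₁-2k
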